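{- Let $q$ be a prime power and let $b\in\mathbb F_{q^3}\setminus\mathbb F_q$. Then $(1,\ b^q+b,\ b^{q+1})$ is a basis of $\mathbb F_{q^3}$ as a vector space over $\mathbb F_q$.
   Context: $\mathbb F_{q^n}$ denotes the finite field with $q^n$ elements. -}

module Defs where

open import Level using (Level; _⊔_)
open import Algebra.Bundles using (CommutativeRing; Semiring)
import Algebra.Definitions.RawSemiring as RawSemiringDefs
open import Data.Nat using (ℕ; _≤_; _^_)
open import Data.Nat.Primality using (Prime)
open import Data.Fin using (Fin)
open import Data.Product using (Σ; ∃; _×_; proj₁)
open import Relation.Nullary using (¬_)
open import Relation.Binary.PropositionalEquality using (_≡_)

IsPrimePower : ℕ → Set
IsPrimePower q = Σ ℕ λ p → Σ ℕ λ k → Prime p × (1 ≤ k) × (q ≡ p ^ k)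

module _ {c ℓ : Level} (K : CommutativeRing c ℓ) where
  open CommutativeRing K

  infixr 8 _^ᴷ_
  _^ᴷ_ : Carrier → ℕ → Carrier
  _^ᴷ_ = RawSemiringDefs._^_ (Semiring.rawSemiring semiring)

  record IsField : Set (c ⊔ ℓ) where
    field
      0≉1     : ¬ (0# ≈ 1#)
      inverse : ∀ x → ¬ (x ≈ 0#) → Σ Carrier λ y → x * y ≈ 1#

  -- A setoid-style cardinality for a subset {x | P x} of K (P = λ _ → ⊤ for all of K):
  -- a bijection between Fin n and the subset, up to ≈.
  record HasCardinality {p : Level} (P : Carrier → Set p) (n : ℕ) : Set (c ⊔ ℓ ⊔ p) where
    field
      to      : Σ Carrier P → Fin n
      from    : Fin n → Σ Carrier P
      to-cong : ∀ x y → proj₁ x ≈ proj₁ y → to x ≡ to y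
      from-to : ∀ x → proj₁ (from (to x)) ≈ proj₁ x
      to-from : ∀ i → to (from i) ≡ i

  record IsSubfield {p : Level} (P : Carrier → Set p) : Set (c ⊔ ℓ ⊔ p) where
    field
      resp  : ∀ {x y} → x ≈ y → P x → P y
      has-0 : P 0#
      has-1 : P 1#
      has-+ : ∀ {x y} → P x → P y → P (x + y)
      has-* : ∀ {x y} → P x → P y → P (x * y)
      has-- : ∀ {x} → P x → P (- x)
      has-⁻¹ : ∀ {x y} → P x → x * y ≈ 1# → P y

  record IsBasis₃ {p : Level} (P : Carrier → Set p) (u v w : Carrier) : Set (c ⊔ ℓ ⊔ p) where
    field
      independent : ∀ a b d → P a → P b → P d →
                    (a * u + b * v + d * w) ≈ 0# → (a ≈ 0#) × (b ≈ 0#) × (d ≈ 0#)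
      spanning    : ∀ x → Σ Carrier λ a → Σ Carrier λ b → Σ Carrier λ d →
                    P a × P b × P d × (x ≈ a * u + b * v + d * w)

-- Let σ x = x ^ q. Since the characteristic p divides the inner binomial coefficients of
-- (x + y) ^ p, σ is a ring endomorphism of K; Fermat's little theorem for F and for K gives
-- σ a = a on F and σ³ = id, and as X ^ q − X has at most q roots, F is exactly the fixed field of σ.
-- A relation a + c (σ b + b) + d σ b · b = 0 over F says that y ↦ (a + c σ b) + (c + d σ b) y
-- vanishes at y = b; applying σ shows it also vanishes at σ² b ≠ b. So c + d σ b = 0, hence d = 0
-- (else σ b = −c/d ∈ F and b = σ³ b = σ b ∈ F), and then c = a = 0. Three independent vectors
-- of a space with q³ elements over a field with q elements span it, by counting coordinates.

module Submission where

open import Defs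
open import Level using (Level; _⊔_)
open import Algebra.Bundles using (CommutativeRing; CommutativeMonoid)
open import Data.Unit.Polymorphic using (⊤; tt)
open import Relation.Nullary using (¬_)

import Data.Nat.Base as ℕ
open import Data.Nat.Base using (ℕ; zero; suc; _∸_; _!; _≤_; _<_; z≤n; s≤s; nonTrivial⇒n>1; nonTrivial⇒≢1)
open import Data.Nat.Properties
  using (_!*_!≢0; <⇒≱; <⇒≤; <-trans; ≤-trans; n<1+n; ∸-monoʳ-<; 1+n≰n; n∸n≡0)
import Data.Nat.Properties as ℕₚ
open import Data.Nat.Divisibility using (_∣_; _∤_; divides; ∣1⇒≡1; ∣⇒≤; m∣m*n)
open import Data.Nat.DivMod using (m/n*n≡m)
open import Data.Nat.Primality using (Prime; euclidsLemma; prime⇒nonTrivial)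
open import Data.Nat.Combinatorics using (_C_; nCk≡n!/k![n-k]!; k![n∸k]!∣n!; nCn≡1)
open import Data.Fin.Base using (Fin; zero; suc; punchOut; punchIn; remQuot; combine; toℕ; fromℕ; inject₁)
open import Data.Fin.Properties
  using (_≟_; any?; punchOut-injective; punchInᵢ≢i; injective⇒≤; suc-injective; combine-remQuot;
         toℕ-fromℕ; toℕ-inject₁; toℕ<n)
open import Data.Fin.Permutation using (Permutation; permutation; _⟨$⟩ʳ_)
open import Data.Vec.Base using (Vec; []; _∷_)
open import Data.Vec.Functional using (replicate)
open import Data.Vec.Properties using (∷-injective)
open import Data.Vec.Relation.Unary.All using (All; []; _∷_)
open import Data.Product using (Σ; ∃; _×_; _,_; proj₁; proj₂; map₁)
open import Data.Sum using (inj₁; inj₂)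
open import Function.Base using (_∘_; case_of_)
open import Function.Definitions using (Injective)
open import Relation.Nullary using (Dec; yes; no; contradiction)
open import Relation.Binary.PropositionalEquality as ≡ using (_≡_; _≢_)
import Algebra.Properties.CommutativeMonoid.Sum as CommutativeMonoidSum
import Algebra.Properties.CommutativeSemiring.Binomial as Binomial
import Algebra.Properties.CommutativeSemiring.Exp as CommutativeSemiringExp
import Algebra.Properties.Ring as RingProperties
import Algebra.Properties.Semiring.Exp as SemiringExp
import Algebra.Properties.Semiring.Mult as SemiringMult
import Algebra.Solver.Ring.NaturalCoefficients.Default as Solver
import Relation.Binary.Reasoning.Setoid as SetoidReasoning

prime∤! : ∀ {p m} → Prime p → m < p → p ∤ m !
prime∤! {m = zero}  pr _   p∣1  = nonTrivial⇒≢1 {{prime⇒nonTrivial pr}} (∣1⇒≡1 p∣1)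
prime∤! {m = suc m} pr m<p p∣m! with euclidsLemma (suc m) (m !) pr p∣m!
... | inj₁ p∣1+m = <⇒≱ m<p (∣⇒≤ p∣1+m)
... | inj₂ p∣m!′ = prime∤! pr (<-trans (n<1+n m) m<p) p∣m!′

nCk*k![n∸k]!≡n! : ∀ {n k} → k ≤ n → (n C k) ℕ.* (k ! ℕ.* (n ∸ k) !) ≡ n !
nCk*k![n∸k]!≡n! {n} {k} k≤n =
  ≡.trans (≡.cong (ℕ._* (k ! ℕ.* (n ∸ k) !)) (nCk≡n!/k![n-k]! k≤n)) (m/n*n≡m {{k !* (n ∸ k) !≢0}} (k![n∸k]!∣n! k≤n))

prime∣binomial : ∀ {p k} → Prime p → 0 < k → k < p → p ∣ p C k
prime∣binomial {suc p-1} {k} pr 0<k k<p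
  with euclidsLemma (suc p-1 C k) (k ! ℕ.* (suc p-1 ∸ k) !) pr
         (≡.subst (suc p-1 ∣_) (≡.sym (nCk*k![n∸k]!≡n! (<⇒≤ k<p))) (m∣m*n (p-1 !)))
... | inj₁ p∣C = p∣C
... | inj₂ p∣k![p∸k]! with euclidsLemma (k !) ((suc p-1 ∸ k) !) pr p∣k![p∸k]!
...   | inj₁ p∣k!     = contradiction p∣k! (prime∤! pr k<p)
...   | inj₂ p∣[p∸k]! = contradiction p∣[p∸k]! (prime∤! pr (∸-monoʳ-< 0<k (<⇒≤ k<p)))

injective⇒surjective : ∀ {n} {f : Fin n → Fin n} → Injective _≡_ _≡_ f → ∀ y → ∃ λ x → f x ≡ y
injective⇒surjective {suc n} {f} f-injective y with any? (λ x → f x ≟ y)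
... | yes found = found
... | no  ∄x    = contradiction (injective⇒≤ punchOut∘f-injective) 1+n≰n
  where
  y≢f : ∀ x → y ≢ f x
  y≢f x y≡fx = ∄x (x , ≡.sym y≡fx)
  punchOut∘f : Fin (suc n) → Fin n
  punchOut∘f x = punchOut (y≢f x)
  punchOut∘f-injective : Injective _≡_ _≡_ punchOut∘f
  punchOut∘f-injective = f-injective ∘ punchOut-injective (y≢f _) (y≢f _)

digits : ∀ {q} m → Fin (q ℕ.^ m) → Vec (Fin q) m
digits zero    _ = []
digits {q} (suc m) t = proj₁ (remQuot {q} (q ℕ.^ m) t) ∷ digits m (proj₂ (remQuot {q} (q ℕ.^ m) t))

digits-injective : ∀ {q} m {t t′ : Fin (q ℕ.^ m)} → digits m t ≡ digits m t′ → t ≡ t′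
digits-injective zero {zero} {zero} _ = ≡.refl
digits-injective {q} (suc m) {t} {t′} eq with ∷-injective eq
... | i≡i′ , ds≡ds′ = ≡.trans (≡.sym (combine-remQuot {q} (q ℕ.^ m) t))
  (≡.trans (≡.cong₂ combine i≡i′ (digits-injective m ds≡ds′)) (combine-remQuot {q} (q ℕ.^ m) t′))

module _ {a ℓ} (M : CommutativeMonoid a ℓ) where
  open CommutativeMonoid M
  open CommutativeMonoidSum M using (sum; sum-remove; sum-cong-≋)
  open SetoidReasoning setoid

  sum-except : ∀ {n} (f g : Fin n → Carrier) j c → (∀ i → i ≢ j → f i ≈ g i) → f j ≈ c ∙ g j →
               sum f ≈ c ∙ sum g
  sum-except {suc n} f g j c f≈g fj≈c∙gj = begin
    sum f                                            ≈⟨ sum-remove {i = j} f ⟩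
    f j ∙ sum (f ∘ punchIn j)                        ≈⟨ ∙-cong fj≈c∙gj (sum-cong-≋ (λ k → f≈g _ (punchInᵢ≢i j k))) ⟩
    (c ∙ g j) ∙ sum (g ∘ punchIn j)                  ≈⟨ assoc c (g j) _ ⟩
    c ∙ (g j ∙ sum (g ∘ punchIn j))                  ≈⟨ ∙-congˡ (sum-remove {i = j} g) ⟨
    c ∙ sum g                                        ∎

module Enumeration {c ℓ p} (K : CommutativeRing c ℓ) {P : CommutativeRing.Carrier K → Set p}
                   {n : ℕ} (card : HasCardinality K P n) where
  open CommutativeRing K
  open HasCardinality card

  element : Fin n → Carrier
  element i = proj₁ (from i)

  element∈ : ∀ i → P (element i)
  element∈ i = proj₂ (from i)

  index : ∀ {x} → P x → Fin n
  index x∈P = to (_ , x∈P)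

  element-index : ∀ {x} (x∈P : P x) → element (index x∈P) ≈ x
  element-index x∈P = from-to (_ , x∈P)

  index-cong : ∀ {x y} (x∈P : P x) (y∈P : P y) → x ≈ y → index x∈P ≡ index y∈P
  index-cong x∈P y∈P = to-cong (_ , x∈P) (_ , y∈P)

  index-injective : ∀ {x y} (x∈P : P x) (y∈P : P y) → index x∈P ≡ index y∈P → x ≈ y
  index-injective x∈P y∈P eq =
    trans (sym (element-index x∈P)) (trans (reflexive (≡.cong element eq)) (element-index y∈P))

  index-element : ∀ {x} (x∈P : P x) {i} → x ≈ element i → index x∈P ≡ i
  index-element x∈P {i} x≈i = ≡.trans (index-cong x∈P (element∈ i) x≈i) (to-from i)

  element-injective : ∀ {i j} → element i ≈ element j → i ≡ j
  element-injective {i} i≈j = ≡.trans (≡.sym (to-from i)) (index-element (element∈ i) i≈j)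

  ≈-dec : ∀ {x y} → P x → P y → Dec (x ≈ y)
  ≈-dec x∈P y∈P with index x∈P ≟ index y∈P
  ... | yes eq  = yes (index-injective x∈P y∈P eq)
  ... | no  neq = no (neq ∘ index-cong x∈P y∈P)

  module Induced {f : Carrier → Carrier} (f∈ : ∀ {x} → P x → P (f x))
                 (f-injective : ∀ {x y} → f x ≈ f y → x ≈ y) where

    private
      f̂ : Fin n → Fin n
      f̂ i = index (f∈ (element∈ i))

      f̂-injective : Injective _≡_ _≡_ f̂
      f̂-injective = element-injective ∘ f-injective ∘ index-injective _ _

      f̂⁻¹ : ∀ i → ∃ λ j → f̂ j ≡ i
      f̂⁻¹ = injective⇒surjective f̂-injective

    induced : Permutation n n
    induced = permutation f̂ (proj₁ ∘ f̂⁻¹) (proj₂ ∘ f̂⁻¹) (λ i → f̂-injective (proj₂ (f̂⁻¹ (f̂ i))))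

    element-induced : ∀ i → element (induced ⟨$⟩ʳ i) ≈ f (element i)
    element-induced i = element-index _

module CommutativeRingProperties {c ℓ} (K : CommutativeRing c ℓ) where
  open CommutativeRing K hiding (zero)
  open SetoidReasoning setoid
  open SemiringExp semiring public using (_^_)
  open SemiringExp semiring using (^-assocʳ; ^-congˡ)
  open SemiringMult semiring public using () renaming (_×_ to _·_)
  open SemiringMult semiring using (×1-homo-*; ×-assoc-*; ×-assocˡ; ×-congʳ; ×-congˡ)
  open CommutativeMonoidSum +-commutativeMonoid using (sum-init-last; sum-cong-≋; sum-replicate-zero)
  open Solver commutativeSemiring using (solve; _:=_; _:+_; _:*_; con)

  ×1-homo-^ : ∀ m k → (m ℕ.^ k) · 1# ≈ (m · 1#) ^ k
  ×1-homo-^ m zero    = +-identityʳ 1#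
  ×1-homo-^ m (suc k) = trans (×1-homo-* m (m ℕ.^ k)) (*-congˡ (×1-homo-^ m k))

  0^n≈0 : ∀ {n} → 0 < n → 0# ^ n ≈ 0#
  0^n≈0 {suc n} _ = zeroˡ (0# ^ n)

  freshman's-dream : ∀ n → (∀ {k} → 0 < k → k < suc n → ∀ x → (suc n C k) · x ≈ 0#) →
                   ∀ x y → (x + y) ^ suc n ≈ x ^ suc n + y ^ suc n
  freshman's-dream n middle≈0 x y = begin
    (x + y) ^ suc n                                               ≈⟨ Binomial.theorem commutativeSemiring (suc n) x y ⟩
    term zero + ∑ (term ∘ suc)                                    ≈⟨ +-congˡ (sum-init-last (term ∘ suc)) ⟩
    term zero + (∑ (term ∘ suc ∘ inject₁) + term (suc (fromℕ n))) ≈⟨ +-cong first (+-cong middle (last (toℕ-fromℕ n))) ⟩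
    y ^ suc n + (0# + x ^ suc n)                                  ≈⟨ +-congˡ (+-identityˡ _) ⟩
    y ^ suc n + x ^ suc n                                         ≈⟨ +-comm _ _ ⟩
    x ^ suc n + y ^ suc n                                         ∎
    where
    open CommutativeMonoidSum +-commutativeMonoid using () renaming (sum to ∑)
    term : Fin (suc (suc n)) → Carrier
    term i = (suc n C toℕ i) · (x ^ toℕ i * y ^ (suc n ∸ toℕ i))
    first : term zero ≈ y ^ suc n
    first = trans (+-identityʳ _) (*-identityˡ _)
    middle : ∑ (term ∘ suc ∘ inject₁) ≈ 0#
    middle = trans (sum-cong-≋ λ j → middle≈0 (s≤s z≤n)
                     (s≤s (≡.subst (_< n) (≡.sym (toℕ-inject₁ j)) (toℕ<n j))) _)
                   (sum-replicate-zero n)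
    last : ∀ {i} → toℕ i ≡ n → term (suc i) ≈ x ^ suc n
    last eq rewrite eq | nCn≡1 (suc n) | n∸n≡0 (suc n) = trans (+-identityʳ _) (*-identityʳ _)

  ^-+-iterate : ∀ {m} → (∀ x y → (x + y) ^ m ≈ x ^ m + y ^ m) →
                ∀ k x y → (x + y) ^ (m ℕ.^ k) ≈ x ^ (m ℕ.^ k) + y ^ (m ℕ.^ k)
  ^-+-iterate ^m-+ zero    x y = trans (*-identityʳ _) (sym (+-cong (*-identityʳ x) (*-identityʳ y)))
  ^-+-iterate {m} ^m-+ (suc k) x y = begin
    (x + y) ^ (m ℕ.* m ℕ.^ k)                    ≈⟨ ^-assocʳ (x + y) m (m ℕ.^ k) ⟨
    ((x + y) ^ m) ^ (m ℕ.^ k)                    ≈⟨ ^-congˡ (m ℕ.^ k) (^m-+ x y) ⟩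
    (x ^ m + y ^ m) ^ (m ℕ.^ k)                  ≈⟨ ^-+-iterate ^m-+ k (x ^ m) (y ^ m) ⟩
    (x ^ m) ^ (m ℕ.^ k) + (y ^ m) ^ (m ℕ.^ k)    ≈⟨ +-cong (^-assocʳ x m (m ℕ.^ k)) (^-assocʳ y m (m ℕ.^ k)) ⟩
    x ^ (m ℕ.* m ℕ.^ k) + y ^ (m ℕ.* m ℕ.^ k)    ∎

  module _ {p} (p·1≈0 : p · 1# ≈ 0#) where

    p·x≈0 : ∀ x → p · x ≈ 0#
    p·x≈0 x = begin
      p · x          ≈⟨ ×-congʳ p (*-identityˡ x) ⟨
      p · (1# * x)   ≈⟨ ×-assoc-* p 1# x ⟨
      (p · 1#) * x   ≈⟨ *-congʳ p·1≈0 ⟩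
      0# * x         ≈⟨ zeroˡ x ⟩
      0#             ∎

    binomial·x≈0 : Prime p → ∀ {k} → 0 < k → k < p → ∀ x → (p C k) · x ≈ 0#
    binomial·x≈0 pr {k} 0<k k<p x with prime∣binomial pr 0<k k<p
    ... | divides s C≡s*p = begin
      (p C k) · x     ≈⟨ ×-congˡ (≡.trans C≡s*p (ℕₚ.*-comm s p)) ⟩
      (p ℕ.* s) · x   ≈⟨ ×-assocˡ x p s ⟨
      p · (s · x)     ≈⟨ p·x≈0 (s · x) ⟩
      0#              ∎

  ^p-+ : ∀ {p} → Prime p → p · 1# ≈ 0# → ∀ x y → (x + y) ^ p ≈ x ^ p + y ^ p
  ^p-+ {zero}    pr _     = contradiction (nonTrivial⇒n>1 0 {{prime⇒nonTrivial pr}}) λ ()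
  ^p-+ {suc p-1} pr p·1≈0 = freshman's-dream p-1 (binomial·x≈0 p·1≈0 pr)

  eval : ∀ {L} → Vec Carrier L → Carrier → Carrier
  eval []       x = 0#
  eval (a ∷ as) x = a + x * eval as x

  quotient : ∀ {L} → Vec Carrier (suc L) → Carrier → Vec Carrier L
  quotient (a ∷ [])      r = []
  quotient (a ∷ a′ ∷ as) r = eval (a′ ∷ as) r ∷ quotient (a′ ∷ as) r

  eval-division : ∀ {L} (as : Vec Carrier (suc L)) r x →
                  eval as x ≈ (x + - r) * eval (quotient as r) x + eval as r
  eval-division (a ∷ []) r x =
    solve 4 (λ a x x-r r → a :+ x :* con 0 := x-r :* con 0 :+ (a :+ r :* con 0)) refl a x (x + - r) r
  eval-division (a ∷ a′ ∷ as) r x = begin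
    a + x * eval (a′ ∷ as) x                    ≈⟨ +-congˡ (*-congˡ (eval-division (a′ ∷ as) r x)) ⟩
    a + x * ((x + - r) * Q + e)                 ≈⟨ +-identityʳ _ ⟨
    a + x * ((x + - r) * Q + e) + 0#            ≈⟨ +-congˡ (trans (*-congˡ (-‿inverseʳ r)) (zeroʳ e)) ⟨
    a + x * ((x + - r) * Q + e) + e * (r + - r) ≈⟨ solve 6 (λ a x -r r e Q →
                                                     a :+ x :* ((x :+ -r) :* Q :+ e) :+ e :* (r :+ -r)
                                                     := (x :+ -r) :* (e :+ x :* Q) :+ (a :+ r :* e))
                                                   refl a x (- r) r e Q ⟩
    (x + - r) * (e + x * Q) + (a + r * e)       ∎
    where
    Q e : Carrier
    Q = eval (quotient (a′ ∷ as) r) x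
    e = eval (a′ ∷ as) r

  constant≈0 : ∀ {a r y} → y ≈ 0# → a + r * y ≈ 0# → a ≈ 0#
  constant≈0 {a} {r} y≈0 a+r*y≈0 = begin
    a            ≈⟨ +-identityʳ a ⟨
    a + 0#       ≈⟨ +-congˡ (trans (*-congˡ y≈0) (zeroʳ r)) ⟨
    a + r * _    ≈⟨ a+r*y≈0 ⟩
    0#           ∎

  quotient≈0∧root⇒≈0 : ∀ {L} (as : Vec Carrier (suc L)) r →
                       All (_≈ 0#) (quotient as r) → eval as r ≈ 0# → All (_≈ 0#) as
  quotient≈0∧root⇒≈0 (a ∷ [])      r []          root = constant≈0 refl root ∷ []
  quotient≈0∧root⇒≈0 (a ∷ a′ ∷ as) r (e≈0 ∷ q≈0) root =
    constant≈0 e≈0 root ∷ quotient≈0∧root⇒≈0 (a′ ∷ as) r q≈0 e≈0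

  combination-difference : ∀ {a b d a′ b′ d′} u v w →
    a * u + b * v + d * w ≈ a′ * u + b′ * v + d′ * w →
    (a + - a′) * u + (b + - b′) * v + (d + - d′) * w ≈ 0#
  combination-difference {a} {b} {d} {a′} {b′} {d′} u v w eq = +-identityˡ-unique _ _ (begin
    ((a + - a′) * u + (b + - b′) * v + (d + - d′) * w) + (a′ * u + b′ * v + d′ * w)
      ≈⟨ solve 9 (λ a-a′ b-b′ d-d′ a′ b′ d′ u v w →
                    (a-a′ :* u :+ b-b′ :* v :+ d-d′ :* w) :+ (a′ :* u :+ b′ :* v :+ d′ :* w)
                    := (a-a′ :+ a′) :* u :+ (b-b′ :+ b′) :* v :+ (d-d′ :+ d′) :* w)
                 refl (a + - a′) (b + - b′) (d + - d′) a′ b′ d′ u v w ⟩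
    ((a + - a′) + a′) * u + ((b + - b′) + b′) * v + ((d + - d′) + d′) * w
      ≈⟨ +-cong (+-cong (*-congʳ (//-rightDividesˡ a′ a)) (*-congʳ (//-rightDividesˡ b′ b)))
                (*-congʳ (//-rightDividesˡ d′ d)) ⟩
    a * u + b * v + d * w
      ≈⟨ eq ⟩
    a′ * u + b′ * v + d′ * w ∎)
    where open RingProperties ring using (+-identityˡ-unique; //-rightDividesˡ)

module FiniteField {c ℓ} (K : CommutativeRing c ℓ) (isField : IsField K)
                   (_≈?_ : ∀ x y → Dec (CommutativeRing._≈_ K x y)) where
  open CommutativeRing K hiding (zero)
  open IsField isField
  open CommutativeRingProperties K
  open SetoidReasoning setoid
  open RingProperties ring using (x∙y⁻¹≈ε⇒x≈y; +-cancelʳ; +-identityʳ-unique; +-inverseʳ-unique)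
  open SemiringExp semiring using (^-congˡ)
  open CommutativeMonoidSum +-commutativeMonoid using () renaming
    (sum to ∑; sum-permute to ∑-permute; sum-cong-≋ to ∑-cong; ∑-distrib-+ to ∑-distrib; sum-replicate to ∑-replicate)
  open CommutativeMonoidSum *-commutativeMonoid using () renaming
    (sum to ∏; sum-permute to ∏-permute; ∑-distrib-+ to ∏-distrib; sum-replicate to ∏-replicate)

  *-cancelˡ-≉0 : ∀ {x y z} → ¬ x ≈ 0# → x * y ≈ x * z → y ≈ z
  *-cancelˡ-≉0 {x} {y} {z} x≉0 xy≈xz = begin
    y                   ≈⟨ x⁻¹*[x*w]≈w y ⟨
    x⁻¹ * (x * y)       ≈⟨ *-congˡ xy≈xz ⟩
    x⁻¹ * (x * z)       ≈⟨ x⁻¹*[x*w]≈w z ⟩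
    z                   ∎
    where
    x⁻¹ : Carrier
    x⁻¹ = proj₁ (inverse x x≉0)
    x⁻¹*[x*w]≈w : ∀ w → x⁻¹ * (x * w) ≈ w
    x⁻¹*[x*w]≈w w = begin
      x⁻¹ * (x * w)   ≈⟨ *-assoc x⁻¹ x w ⟨
      (x⁻¹ * x) * w   ≈⟨ *-congʳ (trans (*-comm x⁻¹ x) (proj₂ (inverse x x≉0))) ⟩
      1# * w          ≈⟨ *-identityˡ w ⟩
      w               ∎

  *-cancelʳ-≉0 : ∀ {x y z} → ¬ x ≈ 0# → y * x ≈ z * x → y ≈ z
  *-cancelʳ-≉0 {x} {y} {z} x≉0 yx≈zx = *-cancelˡ-≉0 x≉0 (trans (*-comm x y) (trans yx≈zx (*-comm z x)))

  x*y≈0⇒y≈0 : ∀ {x y} → ¬ x ≈ 0# → x * y ≈ 0# → y ≈ 0#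
  x*y≈0⇒y≈0 {x} x≉0 xy≈0 = *-cancelˡ-≉0 x≉0 (trans xy≈0 (sym (zeroʳ x)))

  *-≉0 : ∀ {x y} → ¬ x ≈ 0# → ¬ y ≈ 0# → ¬ x * y ≈ 0#
  *-≉0 x≉0 y≉0 = y≉0 ∘ x*y≈0⇒y≈0 x≉0

  x^n≈0⇒x≈0 : ∀ x n → x ^ n ≈ 0# → x ≈ 0#
  x^n≈0⇒x≈0 x zero    1≈0    = contradiction (sym 1≈0) 0≉1
  x^n≈0⇒x≈0 x (suc n) x^1+n≈0 with x ≈? 0#
  ... | yes x≈0 = x≈0
  ... | no  x≉0 = x^n≈0⇒x≈0 x n (x*y≈0⇒y≈0 x≉0 x^1+n≈0)

  ∏-≉0 : ∀ {n} (t : Fin n → Carrier) → (∀ i → ¬ t i ≈ 0#) → ¬ ∏ t ≈ 0#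
  ∏-≉0 {zero}  t t≉0 = 0≉1 ∘ sym
  ∏-≉0 {suc n} t t≉0 = *-≉0 (t≉0 zero) (∏-≉0 (t ∘ suc) (t≉0 ∘ suc))

  p^k·1≈0⇒p·1≈0 : ∀ p k → (p ℕ.^ k) · 1# ≈ 0# → p · 1# ≈ 0#
  p^k·1≈0⇒p·1≈0 p k p^k·1≈0 = x^n≈0⇒x≈0 (p · 1#) k (trans (sym (×1-homo-^ p k)) p^k·1≈0)

  nonzeroOr1 : Carrier → Carrier
  nonzeroOr1 x with x ≈? 0#
  ... | yes _ = 1#
  ... | no  _ = x

  nonzeroOr1-≈0 : ∀ {x} → x ≈ 0# → nonzeroOr1 x ≈ 1#
  nonzeroOr1-≈0 {x} x≈0 with x ≈? 0#
  ... | yes _   = refl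
  ... | no  x≉0 = contradiction x≈0 x≉0

  nonzeroOr1-≉0 : ∀ {x} → ¬ x ≈ 0# → nonzeroOr1 x ≈ x
  nonzeroOr1-≉0 {x} x≉0 with x ≈? 0#
  ... | yes x≈0 = contradiction x≈0 x≉0
  ... | no  _   = refl

  nonzeroOr1≉0 : ∀ x → ¬ nonzeroOr1 x ≈ 0#
  nonzeroOr1≉0 x with x ≈? 0#
  ... | yes _   = 0≉1 ∘ sym
  ... | no  x≉0 = x≉0

  distinct-roots⇒≈0 : ∀ {L} (as : Vec Carrier L) (r : Fin L → Carrier) → (∀ {i j} → r i ≈ r j → i ≡ j) →
                      (∀ i → eval as (r i) ≈ 0#) → All (_≈ 0#) as
  distinct-roots⇒≈0 []          r r-injective roots = []
  distinct-roots⇒≈0 as@(_ ∷ _) r r-injective roots =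
    quotient≈0∧root⇒≈0 as (r zero)
      (distinct-roots⇒≈0 (quotient as (r zero)) (r ∘ suc) (suc-injective ∘ r-injective) quotient-roots)
      (roots zero)
    where
    quotient-roots : ∀ i → eval (quotient as (r zero)) (r (suc i)) ≈ 0#
    quotient-roots i = x*y≈0⇒y≈0 ri-r0≉0 (begin
      (r (suc i) + - r zero) * eval (quotient as (r zero)) (r (suc i))
        ≈⟨ +-identityʳ _ ⟨
      (r (suc i) + - r zero) * eval (quotient as (r zero)) (r (suc i)) + 0#
        ≈⟨ +-congˡ (roots zero) ⟨
      (r (suc i) + - r zero) * eval (quotient as (r zero)) (r (suc i)) + eval as (r zero)
        ≈⟨ eval-division as (r zero) (r (suc i)) ⟨
      eval as (r (suc i))
        ≈⟨ roots (suc i) ⟩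
      0# ∎)
      where
      ri-r0≉0 : ¬ r (suc i) + - r zero ≈ 0#
      ri-r0≉0 ri-r0≈0 with r-injective (x∙y⁻¹≈ε⇒x≈y _ _ ri-r0≈0)
      ... | ()

  monomial : ∀ m → Vec Carrier (suc m)
  monomial zero    = 1# ∷ []
  monomial (suc m) = 0# ∷ monomial m

  eval-monomial : ∀ m x → eval (monomial m) x ≈ x ^ m
  eval-monomial zero    x = trans (+-congˡ (zeroʳ x)) (+-identityʳ 1#)
  eval-monomial (suc m) x = trans (+-identityˡ _) (*-congˡ (eval-monomial m x))

  monomial≉0 : ∀ m → ¬ All (_≈ 0#) (monomial m)
  monomial≉0 zero    (1≈0 ∷ []) = 0≉1 (sym 1≈0)
  monomial≉0 (suc m) (_ ∷ m≈0)  = monomial≉0 m m≈0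

  X^[2+m]-X : ∀ m → Vec Carrier (3 ℕ.+ m)
  X^[2+m]-X m = 0# ∷ - 1# ∷ monomial m

  X^[2+m]-X≉0 : ∀ m → ¬ All (_≈ 0#) (X^[2+m]-X m)
  X^[2+m]-X≉0 m (_ ∷ _ ∷ m≈0) = monomial≉0 m m≈0

  root-of-X^[2+m]-X : ∀ m {x} → x ^ (2 ℕ.+ m) ≈ x → eval (X^[2+m]-X m) x ≈ 0#
  root-of-X^[2+m]-X m {x} x^[2+m]≈x = begin
    0# + x * (- 1# + x * eval (monomial m) x)  ≈⟨ +-identityˡ _ ⟩
    x * (- 1# + x * eval (monomial m) x)       ≈⟨ *-congˡ (+-congˡ (*-congˡ (eval-monomial m x))) ⟩
    x * (- 1# + x ^ suc m)                     ≈⟨ distribˡ x (- 1#) _ ⟩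
    x * - 1# + x ^ (2 ℕ.+ m)                   ≈⟨ +-cong (trans (*-comm x (- 1#)) (-1*x≈-x x)) x^[2+m]≈x ⟩
    - x + x                                    ≈⟨ -‿inverseˡ x ⟩
    0#                                         ∎
    where open RingProperties ring using (-1*x≈-x)

  x^n≈x-has-≤n-solutions : ∀ {n} → 2 ≤ n → (r : Fin (suc n) → Carrier) → (∀ {i j} → r i ≈ r j → i ≡ j) →
                           ¬ (∀ i → r i ^ n ≈ r i)
  x^n≈x-has-≤n-solutions {suc (suc m)} (s≤s (s≤s z≤n)) r r-injective solutions =
    X^[2+m]-X≉0 m (distinct-roots⇒≈0 (X^[2+m]-X m) r r-injective (root-of-X^[2+m]-X m ∘ solutions))

  module FiniteSubfield {p} {P : Carrier → Set p} (subfield : IsSubfield K P)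
                        {n} (card : HasCardinality K P n) where
    open IsSubfield subfield
    open Enumeration K card

    2≤n : 2 ≤ n
    2≤n = injective⇒≤ {f = zeroOrOne} zeroOrOne-injective
      where
      zeroOrOne : Fin 2 → Fin n
      zeroOrOne zero       = index has-0
      zeroOrOne (suc zero) = index has-1
      zeroOrOne-injective : Injective _≡_ _≡_ zeroOrOne
      zeroOrOne-injective {zero}     {zero}     _  = ≡.refl
      zeroOrOne-injective {zero}     {suc zero} eq = contradiction (index-injective has-0 has-1 eq) 0≉1
      zeroOrOne-injective {suc zero} {zero}     eq = contradiction (index-injective has-0 has-1 (≡.sym eq)) 0≉1
      zeroOrOne-injective {suc zero} {suc zero} _  = ≡.refl

    element≉0 : ∀ {i} → i ≢ index has-0 → ¬ element i ≈ 0#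
    element≉0 i≢0 i≈0 = i≢0 (≡.sym (index-element has-0 (sym i≈0)))

    n·a≈0 : ∀ {a} → P a → n · a ≈ 0#
    n·a≈0 {a} a∈P = +-identityʳ-unique S (n · a) (sym (begin
      S                                ≈⟨ ∑-permute element π ⟩
      ∑ (λ i → element (π ⟨$⟩ʳ i))     ≈⟨ ∑-cong element-induced ⟩
      ∑ (λ i → element i + a)          ≈⟨ ∑-distrib element (replicate n a) ⟩
      S + ∑ (replicate n a)            ≈⟨ +-congˡ (∑-replicate n) ⟩
      S + n · a                        ∎))
      where
      S : Carrier
      S = ∑ element
      open Induced (λ x∈P → has-+ x∈P a∈P) (+-cancelʳ a _ _) renaming (induced to π)

    -- Counting 0 as 1, the product over P is invariant under x ↦ a x; factorwise it gains a ^ n,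
    -- except at 0, where it gains only a.
    fermat : ∀ {a} → P a → a ^ n ≈ a
    fermat {a} a∈P with a ≈? 0#
    ... | yes a≈0 = trans (^-congˡ n a≈0) (trans (0^n≈0 (≤-trans (s≤s z≤n) 2≤n)) (sym a≈0))
    ... | no  a≉0 = *-cancelʳ-≉0 (∏-≉0 (u ∘ element) (nonzeroOr1≉0 ∘ element)) (begin
      a ^ n * ∏ (u ∘ element)               ≈⟨ *-congʳ (∏-replicate n) ⟨
      ∏ (replicate n a) * ∏ (u ∘ element)   ≈⟨ ∏-distrib (replicate n a) (u ∘ element) ⟨
      ∏ (λ i → a * u (element i))           ≈⟨ sum-except *-commutativeMonoid _ _ (index has-0) a away-from-0 at-0 ⟩
      a * ∏ (λ i → u (element (π ⟨$⟩ʳ i)))  ≈⟨ *-congˡ (∏-permute (u ∘ element) π) ⟨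
      a * ∏ (u ∘ element)                   ∎)
      where
      u : Carrier → Carrier
      u = nonzeroOr1
      open Induced (has-* a∈P) (*-cancelˡ-≉0 a≉0) renaming (induced to π)
      away-from-0 : ∀ i → i ≢ index has-0 → a * u (element i) ≈ u (element (π ⟨$⟩ʳ i))
      away-from-0 i i≢0 = begin
        a * u (element i)           ≈⟨ *-congˡ (nonzeroOr1-≉0 (element≉0 i≢0)) ⟩
        a * element i               ≈⟨ element-induced i ⟨
        element (π ⟨$⟩ʳ i)          ≈⟨ nonzeroOr1-≉0 πi≉0 ⟨
        u (element (π ⟨$⟩ʳ i))      ∎
        where
        πi≉0 : ¬ element (π ⟨$⟩ʳ i) ≈ 0#
        πi≉0 = *-≉0 a≉0 (element≉0 i≢0) ∘ trans (sym (element-induced i))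
      at-0 : a * u (element (index has-0)) ≈ a * u (element (π ⟨$⟩ʳ index has-0))
      at-0 = *-congˡ (trans (nonzeroOr1-≈0 (element-index has-0)) (sym (nonzeroOr1-≈0 π0≈0)))
        where
        π0≈0 : element (π ⟨$⟩ʳ index has-0) ≈ 0#
        π0≈0 = trans (element-induced _) (trans (*-congˡ (element-index has-0)) (zeroʳ a))

    ^n-+ : IsPrimePower n → ∀ x y → (x + y) ^ n ≈ x ^ n + y ^ n
    ^n-+ (p , k , pr , _ , n≡p^k) =
      ≡.subst (λ m → ∀ x y → (x + y) ^ m ≈ x ^ m + y ^ m) (≡.sym n≡p^k) (^-+-iterate (^p-+ pr p·1≈0) k)
      where
      p·1≈0 : p · 1# ≈ 0#
      p·1≈0 = p^k·1≈0⇒p·1≈0 p k (≡.subst (λ m → m · 1# ≈ 0#) n≡p^k (n·a≈0 has-1))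

    ∈? : ∀ x → Dec (P x)
    ∈? x with any? (λ i → x ≈? element i)
    ... | yes (i , x≈i) = yes (resp (sym x≈i) (element∈ i))
    ... | no  ∄i        = no λ x∈P → ∄i (index x∈P , sym (element-index x∈P))

    x^n≈x⇒∈ : ∀ {x} → x ^ n ≈ x → P x
    x^n≈x⇒∈ {x} x^n≈x with ∈? x
    ... | yes x∈P = x∈P
    ... | no  x∉P = contradiction solutions (x^n≈x-has-≤n-solutions 2≤n r r-injective)
      where
      r : Fin (suc n) → Carrier
      r zero    = x
      r (suc i) = element i
      r-injective : ∀ {i j} → r i ≈ r j → i ≡ j
      r-injective {zero}  {zero}  _    = ≡.refl
      r-injective {zero}  {suc j} x≈j  = contradiction (resp (sym x≈j) (element∈ j)) x∉P
      r-injective {suc i} {zero}  i≈x  = contradiction (resp i≈x (element∈ i)) x∉P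
      r-injective {suc i} {suc j} i≈j  = ≡.cong suc (element-injective i≈j)
      solutions : ∀ i → r i ^ n ≈ r i
      solutions zero    = x^n≈x
      solutions (suc i) = fermat (element∈ i)

  affine-two-roots⇒≈0 : ∀ {p} {P : Carrier → Set p} → IsSubfield K P →
    ∀ {a c d β y₁ y₂} → P a → P c → P d → ¬ P β → ¬ y₁ ≈ y₂ →
    (a + c * β) + (c + d * β) * y₁ ≈ 0# → (a + c * β) + (c + d * β) * y₂ ≈ 0# →
    (a ≈ 0#) × (c ≈ 0#) × (d ≈ 0#)
  affine-two-roots⇒≈0 subfield {a} {c} {d} {β} {y₁} {y₂} a∈P c∈P d∈P β∉P y₁≉y₂ root₁ root₂ = a≈0 , c≈0 , d≈0
    where
    open IsSubfield subfield
    open RingProperties ring using (+-cancelˡ)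

    slope≈0 : c + d * β ≈ 0#
    slope≈0 with (c + d * β) ≈? 0#
    ... | yes slope≈0 = slope≈0
    ... | no  slope≉0 = contradiction (*-cancelˡ-≉0 slope≉0 (+-cancelˡ _ _ _ (trans root₁ (sym root₂)))) y₁≉y₂

    d≈0 : d ≈ 0#
    d≈0 with d ≈? 0#
    ... | yes d≈0 = d≈0
    ... | no  d≉0 = contradiction (resp d⁻¹[-c]≈β (has-* (has-⁻¹ d∈P d*d⁻¹≈1) (has-- c∈P))) β∉P
      where
      d⁻¹ : Carrier
      d⁻¹ = proj₁ (inverse d d≉0)
      d*d⁻¹≈1 : d * d⁻¹ ≈ 1#
      d*d⁻¹≈1 = proj₂ (inverse d d≉0)
      d⁻¹[-c]≈β : d⁻¹ * - c ≈ β
      d⁻¹[-c]≈β = *-cancelˡ-≉0 d≉0 (begin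
        d * (d⁻¹ * - c)   ≈⟨ *-assoc d d⁻¹ (- c) ⟨
        (d * d⁻¹) * - c   ≈⟨ *-congʳ d*d⁻¹≈1 ⟩
        1# * - c          ≈⟨ *-identityˡ (- c) ⟩
        - c               ≈⟨ +-inverseʳ-unique c (d * β) slope≈0 ⟨
        d * β             ∎)

    c≈0 : c ≈ 0#
    c≈0 = begin
      c            ≈⟨ +-identityʳ c ⟨
      c + 0#       ≈⟨ +-congˡ (trans (*-congʳ d≈0) (zeroˡ β)) ⟨
      c + d * β    ≈⟨ slope≈0 ⟩
      0#           ∎

    a≈0 : a ≈ 0#
    a≈0 = begin
      a                                  ≈⟨ +-identityʳ a ⟨
      a + 0#                             ≈⟨ +-congˡ (trans (*-congʳ c≈0) (zeroˡ β)) ⟨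
      a + c * β                          ≈⟨ +-identityʳ _ ⟨
      (a + c * β) + 0#                   ≈⟨ +-congˡ (trans (*-congʳ slope≈0) (zeroˡ y₁)) ⟨
      (a + c * β) + (c + d * β) * y₁     ≈⟨ root₁ ⟩
      0#                                 ∎

  ⊤-subfield : IsSubfield K {ℓ} (λ _ → ⊤)
  ⊤-subfield = record
    { resp = λ _ _ → tt ; has-0 = tt ; has-1 = tt ; has-+ = λ _ _ → tt
    ; has-* = λ _ _ → tt ; has-- = λ _ → tt ; has-⁻¹ = λ _ _ → tt }

  Independent₃ : ∀ {p} → (Carrier → Set p) → Carrier → Carrier → Carrier → Set (c ⊔ ℓ ⊔ p)
  Independent₃ P u v w = ∀ a b d → P a → P b → P d →
                         a * u + b * v + d * w ≈ 0# → (a ≈ 0#) × (b ≈ 0#) × (d ≈ 0#)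

  InSpan₃ : ∀ {p} → (Carrier → Set p) → Carrier → Carrier → Carrier → Carrier → Set (c ⊔ ℓ ⊔ p)
  InSpan₃ P u v w x = Σ Carrier λ a → Σ Carrier λ b → Σ Carrier λ d →
                      P a × P b × P d × (x ≈ a * u + b * v + d * w)

  Spans₃ : ∀ {p} → (Carrier → Set p) → Carrier → Carrier → Carrier → Set (c ⊔ ℓ ⊔ p)
  Spans₃ P u v w = ∀ x → InSpan₃ P u v w x

  module _ {p} {P : Carrier → Set p} (subfield : IsSubfield K P) {q} (cardP : HasCardinality K P q)
           (cardK : HasCardinality K {ℓ} (λ _ → ⊤) (q ℕ.^ 3)) {u v w : Carrier} where
    open IsSubfield subfield
    open Enumeration K cardP
    private module KE = Enumeration K cardK

    independent⇒spans : Independent₃ P u v w → Spans₃ P u v w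
    independent⇒spans independent x = inSpan (digits 3 (proj₁ hit)) (KE.index-injective tt tt (≡.sym (proj₂ hit)))
      where
      combination : Vec (Fin q) 3 → Carrier
      combination (i ∷ j ∷ k ∷ []) = element i * u + element j * v + element k * w

      inSpan : ∀ ds → x ≈ combination ds → InSpan₃ P u v w x
      inSpan (i ∷ j ∷ k ∷ []) x≈ds = _ , _ , _ , element∈ i , element∈ j , element∈ k , x≈ds

      difference∈ : ∀ i i′ → P (element i + - element i′)
      difference∈ i i′ = has-+ (element∈ i) (has-- (element∈ i′))

      difference≈0⇒≡ : ∀ {i i′} → element i + - element i′ ≈ 0# → i ≡ i′
      difference≈0⇒≡ = element-injective ∘ x∙y⁻¹≈ε⇒x≈y _ _

      combination-injective : ∀ {is js} → combination is ≈ combination js → is ≡ js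
      combination-injective {i ∷ j ∷ k ∷ []} {i′ ∷ j′ ∷ k′ ∷ []} eq =
        case independent (element i + - element i′) (element j + - element j′) (element k + - element k′)
                         (difference∈ i i′) (difference∈ j j′) (difference∈ k k′) (combination-difference u v w eq)
        of λ { (i≈i′ , j≈j′ , k≈k′) → ≡.cong₂ _∷_ (difference≈0⇒≡ i≈i′)
                 (≡.cong₂ _∷_ (difference≈0⇒≡ j≈j′) (≡.cong (_∷ []) (difference≈0⇒≡ k≈k′))) }

      combinationIndex : Fin (q ℕ.^ 3) → Fin (q ℕ.^ 3)
      combinationIndex t = KE.index {combination (digits 3 t)} tt

      combinationIndex-injective : Injective _≡_ _≡_ combinationIndex
      combinationIndex-injective = digits-injective 3 ∘ combination-injective ∘ KE.index-injective tt tt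

      hit : ∃ λ t → combinationIndex t ≡ KE.index {x} tt
      hit = injective⇒surjective combinationIndex-injective (KE.index tt)

  module CubicExtension {p} {F : Carrier → Set p} (subfield : IsSubfield K F) {q} (cardF : HasCardinality K F q)
                        (cardK : HasCardinality K {ℓ} (λ _ → ⊤) (q ℕ.^ 3))
                        (^q-+ : ∀ x y → (x + y) ^ q ≈ x ^ q + y ^ q) where
    open IsSubfield subfield
    open FiniteSubfield subfield cardF using (fermat; x^n≈x⇒∈)
    open FiniteSubfield ⊤-subfield cardK using () renaming (fermat to fermatᴷ)
    open SemiringExp semiring using (^-congʳ; ^-assocʳ; ^-homo-*)
    open CommutativeSemiringExp commutativeSemiring using (^-distrib-*)
    open Solver commutativeSemiring using (solve; _:=_; _:+_; _:*_)

    σ : Carrier → Carrier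
    σ x = x ^ q

    σ-cong : ∀ {x y} → x ≈ y → σ x ≈ σ y
    σ-cong = ^-congˡ q

    σ³≈id : ∀ x → σ (σ (σ x)) ≈ x
    σ³≈id x = begin
      ((x ^ q) ^ q) ^ q          ≈⟨ ^-congˡ q (^-assocʳ x q q) ⟩
      (x ^ (q ℕ.* q)) ^ q        ≈⟨ ^-assocʳ x (q ℕ.* q) q ⟩
      x ^ (q ℕ.* q ℕ.* q)        ≈⟨ ^-congʳ x q*q*q≡q^3 ⟩
      x ^ (q ℕ.^ 3)              ≈⟨ fermatᴷ tt ⟩
      x                          ∎
      where
      q*q*q≡q^3 : q ℕ.* q ℕ.* q ≡ q ℕ.^ 3
      q*q*q≡q^3 = ≡.trans (ℕₚ.*-assoc q q q) (≡.cong (λ m → q ℕ.* (q ℕ.* m)) (≡.sym (ℕₚ.*-identityʳ q)))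

    module _ {b} (b∉F : ¬ F b) where
      private
        β γ : Carrier
        β = σ b
        γ = σ β

      σb≉b : ¬ σ b ≈ b
      σb≉b = b∉F ∘ x^n≈x⇒∈

      γ≉b : ¬ γ ≈ b
      γ≉b γ≈b = σb≉b (trans (sym (σ-cong γ≈b)) (σ³≈id b))

      β∉F : ¬ F β
      β∉F β∈F = σb≉b (sym (trans (sym (σ³≈id b)) (trans (σ-cong (fermat β∈F)) (fermat β∈F))))

      independent : Independent₃ F 1# (β + b) (b ^ (q ℕ.+ 1))
      independent a c d a∈F c∈F d∈F combination≈0 =
        map₁ (trans (sym (*-identityʳ a)))
          (affine-two-roots⇒≈0 subfield (has-* a∈F has-1) c∈F d∈F β∉F (γ≉b ∘ sym) affine-b affine-γ)
        where
        relation : Carrier → Carrier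
        relation y = a * 1# + c * (σ y + y) + d * (σ y * y)

        rearrange : ∀ z y → a * 1# + c * (z + y) + d * (z * y) ≈ (a * 1# + c * z) + (c + d * z) * y
        rearrange = solve 5 (λ A c d z y → A :+ c :* (z :+ y) :+ d :* (z :* y) := (A :+ c :* z) :+ (c :+ d :* z) :* y)
                            refl (a * 1#) c d

        σ-relation : ∀ y → σ (relation y) ≈ relation (σ y)
        σ-relation y = begin
          σ (a * 1# + c * (σ y + y) + d * (σ y * y))
            ≈⟨ trans (^q-+ _ _) (+-congʳ (^q-+ _ _)) ⟩
          σ (a * 1#) + σ (c * (σ y + y)) + σ (d * (σ y * y))
            ≈⟨ +-cong (+-cong (^-distrib-* a 1# q) (trans (^-distrib-* c _ q) (*-congˡ (^q-+ _ _))))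
                      (trans (^-distrib-* d _ q) (*-congˡ (^-distrib-* _ _ q))) ⟩
          σ a * σ 1# + σ c * (σ (σ y) + σ y) + σ d * (σ (σ y) * σ y)
            ≈⟨ +-cong (+-cong (*-cong (fermat a∈F) (fermat has-1)) (*-congʳ (fermat c∈F))) (*-congʳ (fermat d∈F)) ⟩
          relation (σ y) ∎

        relation-b : relation b ≈ 0#
        relation-b = trans (+-congˡ (*-congˡ βb≈b^[q+1])) combination≈0
          where
          βb≈b^[q+1] : β * b ≈ b ^ (q ℕ.+ 1)
          βb≈b^[q+1] = sym (trans (^-homo-* b q 1) (*-congˡ (*-identityʳ b)))

        affine-b : (a * 1# + c * β) + (c + d * β) * b ≈ 0#
        affine-b = trans (sym (rearrange β b)) relation-b

        affine-γ : (a * 1# + c * β) + (c + d * β) * γ ≈ 0#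
        affine-γ = begin
          (a * 1# + c * β) + (c + d * β) * γ        ≈⟨ rearrange β γ ⟨
          a * 1# + c * (β + γ) + d * (β * γ)        ≈⟨ +-cong (+-congˡ (*-congˡ (+-comm β γ))) (*-congˡ (*-comm β γ)) ⟩
          relation β                                ≈⟨ σ-relation b ⟨
          σ (relation b)                            ≈⟨ σ-cong relation-b ⟩
          σ 0#                                      ≈⟨ fermat has-0 ⟩
          0#                                        ∎

      basis : IsBasis₃ K F 1# (β + b) (b ^ (q ℕ.+ 1))
      basis = record { independent = independent ; spanning = independent⇒spans subfield cardF cardK independent }

open import Data.Nat using (ℕ; _^_)

mainTheorem1 : {c ℓ p : Level} (q : ℕ) → IsPrimePower q →
    (K : CommutativeRing c ℓ) → IsField K →
    HasCardinality K {ℓ} (λ _ → ⊤) (q ^ 3) →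
    (F : CommutativeRing.Carrier K → Set p) → IsSubfield K F → HasCardinality K F q →
    (b : CommutativeRing.Carrier K) → ¬ F b →
    let open CommutativeRing K in
    IsBasis₃ K F 1# (_^ᴷ_ K b q + b) (_^ᴷ_ K b (q Data.Nat.+ 1))
mainTheorem1 q q-primePower K isField cardK F subfield cardF b b∉F =
  CubicExtension.basis subfield cardF cardK (FiniteSubfield.^n-+ subfield cardF q-primePower) b∉F
  where open FiniteField K isField (λ x y → Enumeration.≈-dec K cardK {x} {y} tt tt)
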